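{- Let $u\in\mathcal W_n$, $t>0$ an integer, and $q$ a queue. Assume that the word $q(u)$ has at least one letter equal to $t$, is weakly decreasing up to level $t$, and has exactly $|q|$ letters that are at most $t$. Then: (a) the word $u$ is weakly decreasing up to level $t-1$; (b) for each $h\in\{1,\dots,t-1\}$, $$\{p\in\{1,\dots,n\}: q(u)_p=h\}\succeq\{p\in\{1,\dots,n\}: u_p=h\}\gg\{p\in\{1,\dots,n\}: q(u)_p=h+1\}.$$
   Context: Sites are $1,\dots,n$; they are totally ordered by $1<\cdots<n$ but arranged cyclically for the queue action. $\mathcal{W}_n$ is the set of words $u=u_1\cdots u_n$ with letters in $\{1,2,\dots\}$. A queue is a subset $q\subseteq\{1,\dots,n\}$. For a queue $q$ and $u$, $v=q(u)$: choose a permutation $(i_1,\dots,i_n)$ of $(1,\dots,n)$ with $u_{i_1}\le\cdots\le u_{i_n}$; Phase I: for $i=i_n,\dots,i_{|q|+1}$ in order, take the first site $j$ weakly to the left of $i$ (cyclically) with $j\notin q$ and $v_j$ unset, set $v_j=u_i+1$; Phase II: for $i=i_1,\dots,i_{|q|}$ in order, take the first site $j$ weakly to the right of $i$ (cyclically) with $j\in q$ and $v_j$ unset, set $v_j=u_i$. A word $w$ is weakly decreasing up to level $t$ if every two sites $i<j$ with $w_j\le t$ satisfy $w_i\ge w_j$. For $A=\{a_1>\cdots>a_\alpha\}$, $B=\{b_1>\cdots>b_\beta\}$ subsets of $\{1,\dots,n\}$, $A\succeq B$ means $\alpha=\beta$ and $a_s\ge b_s$ for all $s$; $A\gg B$ means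 $a>b$ for all $a\in A$, $b\in B$. -}

module Defs where

open import Data.Nat as ℕ using (ℕ; zero; suc; _+_; _≤_; _<_; _∸_; _≟_; _≤?_)
open import Data.Nat.DivMod using (_%_; m%n<n)
open import Data.Bool using (Bool; true; false; not; _∧_; if_then_else_)
open import Data.Maybe using (Maybe; just; nothing; is-nothing; fromMaybe)
open import Data.Fin as Fin using (Fin; toℕ; fromℕ; fromℕ<; inject₁)
open import Data.Fin.Subset using (Subset; ∣_∣)
open import Data.Vec using (lookup; tabulate)
open import Data.List as List using (List; []; _∷_; reverse; take; drop)
open import Data.List.Relation.Binary.Permutation.Propositional using (_↭_)
open import Data.List.Relation.Unary.Linked using (Linked)
open import Data.List.Relation.Binary.Pointwise using (Pointwise)
open import Relation.Nullary.Decidable using (⌊_⌋)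
open import Relation.Binary.PropositionalEquality using (_≡_)

-- Sites 1,…,n are represented by Fin n (site k ↦ Fin index k-1); order preserved.
-- A word is a map from sites to letters (letters ≥ 1 imposed as hypothesis).
Word : ℕ → Set
Word n = Fin n → ℕ

Queue : ℕ → Set
Queue n = Subset n

PWord : ℕ → Set
PWord n = Fin n → Maybe ℕ

cpred : ∀ {m} → Fin (suc m) → Fin (suc m)
cpred {m} Fin.zero = fromℕ m
cpred (Fin.suc i) = inject₁ i

csucc : ∀ {m} → Fin (suc m) → Fin (suc m)
csucc {m} i = fromℕ< (m%n<n (suc (toℕ i)) (suc m))

searchLeft : ∀ {m} → (Fin (suc m) → Bool) → Fin (suc m) → ℕ → Maybe (Fin (suc m))
searchLeft ok i zero = nothing
searchLeft ok i (suc k) = if ok i then just i else searchLeft ok (cpred i) k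

searchRight : ∀ {m} → (Fin (suc m) → Bool) → Fin (suc m) → ℕ → Maybe (Fin (suc m))
searchRight ok i zero = nothing
searchRight ok i (suc k) = if ok i then just i else searchRight ok (csucc i) k

firstLeft : ∀ {n} → (Fin n → Bool) → Fin n → Maybe (Fin n)
firstLeft {suc m} ok i = searchLeft ok i (suc m)

firstRight : ∀ {n} → (Fin n → Bool) → Fin n → Maybe (Fin n)
firstRight {suc m} ok i = searchRight ok i (suc m)

setAt : ∀ {n} → PWord n → Fin n → ℕ → PWord n
setAt v j x k = if ⌊ j Fin.≟ k ⌋ then just x else v k

phaseI : ∀ {n} → Queue n → Word n → List (Fin n) → PWord n → PWord n
phaseI q u [] v = v
phaseI q u (i ∷ is) v with firstLeft (λ j → not (lookup q j) ∧ is-nothing (v j)) i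
... | just j  = phaseI q u is (setAt v j (suc (u i)))
... | nothing = phaseI q u is v

phaseII : ∀ {n} → Queue n → Word n → List (Fin n) → PWord n → PWord n
phaseII q u [] v = v
phaseII q u (i ∷ is) v with firstRight (λ j → lookup q j ∧ is-nothing (v j)) i
... | just j  = phaseII q u is (setAt v j (u i))
... | nothing = phaseII q u is v

IsSortingOrder : ∀ {n} → Word n → List (Fin n) → Set
IsSortingOrder {n} u is = (is ↭ List.allFin n) × Linked (λ i j → u i ≤ u j) is
  where open import Data.Product using (_×_)

-- Phase I processes i_n,…,i_{|q|+1}; Phase II processes i_1,…,i_{|q|}.
-- (Every site gets filled; the default 0 for unfilled sites never occurs.)
queueAct : ∀ {n} → Queue n → Word n → List (Fin n) → Word n
queueAct q u is p =
  fromMaybe 0 (phaseII q u (take ∣ q ∣ is) (phaseI q u (reverse (drop ∣ q ∣ is)) (λ _ → nothing)) p)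

WeaklyDecUpTo : ∀ {n} → ℕ → Word n → Set
WeaklyDecUpTo t w = ∀ i j → i Fin.< j → w j ≤ t → w j ≤ w i

levelSet : ∀ {n} → Word n → ℕ → Subset n
levelSet w h = tabulate (λ p → ⌊ w p ≟ h ⌋)

atMostSet : ∀ {n} → Word n → ℕ → Subset n
atMostSet w t = tabulate (λ p → ⌊ w p ≤? t ⌋)

elemsDesc : ∀ {n} → Subset n → List (Fin n)
elemsDesc {n} A = reverse (List.filterᵇ (lookup A) (List.allFin n))

_⪰_ : ∀ {n} → Subset n → Subset n → Set
A ⪰ B = Pointwise (λ a b → toℕ b ≤ toℕ a) (elemsDesc A) (elemsDesc B)

_≫_ : ∀ {n} → Subset n → Subset n → Set
A ≫ B = ∀ a b → lookup A a ≡ true → lookup B b ≡ true → b Fin.< a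

-- Phase II writes the ∣ q ∣ smallest letters of u on the sites of q, and Phase I writes the
-- others, each increased by one, on the remaining sites. Counting the sites of q(u) with letter
-- at most t shows that these are exactly the sites of q, so every letter of u below t is written
-- in Phase II. There the letters are processed in increasing order, each one going to the first
-- free site of q weakly to its right. Since q(u) is weakly decreasing up to t and the site holding
-- t is still free, the search from a letter x < t never wraps around, and every site of q right of
-- x ends up with a letter at most x. This gives (a) and the ≫ half of (b); for ⪰, the placement maps
-- the sites of u at level h bijectively onto those of q(u) at level h, moving each weakly to the
-- right, and for sorted lists of equal length this is equivalent to comparing all tail counts.

module Submission where

open import Defs
open import Algebra.Properties.CommutativeSemigroup as CommSemigroupProperties using ()
open import Data.Bool using (Bool; true; false; not; _∧_)
open import Data.Bool.Properties using (∧-identityʳ; ∧-zeroʳ; ∧-conicalˡ; ∧-conicalʳ; not-injective)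
open import Data.Fin as Fin using (Fin; toℕ; fromℕ; inject₁)
import Data.Fin.Properties as FinP
open import Data.Fin.Subset using (Subset; ∣_∣)
import Data.Fin.Subset.Properties as SubsetP
open import Data.List as List using (List; []; _∷_; map; length; _++_; allFin; filterᵇ; take; drop; reverse)
import Data.List.Properties as ListP
open import Data.List.Membership.Propositional using (_∈_)
import Data.List.Membership.Propositional.Properties as ∈P
open import Data.List.Relation.Binary.Permutation.Propositional as Perm using (_↭_; ↭-sym)
import Data.List.Relation.Binary.Permutation.Propositional.Properties as PermP
open import Data.List.Relation.Binary.Pointwise as Pointwise using (Pointwise; []; _∷_)
open import Data.List.Relation.Unary.All as All using (All; _∷_)
open import Data.List.Relation.Unary.AllPairs using (AllPairs; _∷_)
import Data.List.Relation.Unary.AllPairs.Properties as AllPairsP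
open import Data.List.Relation.Unary.Any using (here; there)
import Data.List.Relation.Unary.Any.Properties as AnyP
open import Data.List.Relation.Unary.Linked using (Linked)
import Data.List.Relation.Unary.Linked.Properties as LinkedP
open import Data.Maybe using (Maybe; just; nothing; is-nothing; fromMaybe)
open import Data.Maybe.Properties using (just-injective)
open import Data.Nat as ℕ using (ℕ; zero; suc; _+_; _≤_; _<_; _∸_; z≤n; s≤s; _≤?_; _≟_)
import Data.Nat.Properties as ℕP
open import Data.Nat.DivMod using (_%_; m<n⇒m%n≡m; n%n≡0)
open import Data.Product using (_×_; _,_; ∃; proj₁; proj₂)
open import Data.Sum using (_⊎_; inj₁; inj₂)
open import Data.Vec using (lookup) renaming ([] to []ᵛ; _∷_ to _∷ᵛ_)
import Data.Vec.Properties as VecP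
open import Function using (_∘_; const; case_of_)
open import Relation.Nullary using (¬_; Dec; yes; no; contradiction)
open import Relation.Nullary.Decidable using (⌊_⌋; isYes≗does; dec-true; dec-false)
open import Relation.Binary.PropositionalEquality

open CommSemigroupProperties ℕP.+-commutativeSemigroup using (x∙yz≈y∙xz; xy∙z≈y∙xz)

⌊⌋≡true⇒ : ∀ {a} {A : Set a} (a? : Dec A) → ⌊ a? ⌋ ≡ true → A
⌊⌋≡true⇒ (yes a) _ = a

⌊⌋≡true : ∀ {a} {A : Set a} (a? : Dec A) → A → ⌊ a? ⌋ ≡ true
⌊⌋≡true a? a = trans (isYes≗does a?) (dec-true a? a)

⌊⌋≡false : ∀ {a} {A : Set a} (a? : Dec A) → ¬ A → ⌊ a? ⌋ ≡ false
⌊⌋≡false a? ¬a = trans (isYes≗does a?) (dec-false a? ¬a)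

indicator : Bool → ℕ
indicator true  = 1
indicator false = 0

indicator-mono : ∀ {a b} → (a ≡ true → b ≡ true) → indicator a ≤ indicator b
indicator-mono {false} _  = z≤n
indicator-mono {true}  a⇒b rewrite a⇒b refl = ℕP.≤-refl

count : ∀ {n} → (Fin n → Bool) → ℕ
count {zero}  f = 0
count {suc n} f = indicator (f Fin.zero) + count (f ∘ Fin.suc)

count-cong : ∀ {n} {f g : Fin n → Bool} → (∀ i → f i ≡ g i) → count f ≡ count g
count-cong {zero}  _   = refl
count-cong {suc _} f≗g = cong₂ _+_ (cong indicator (f≗g Fin.zero)) (count-cong (f≗g ∘ Fin.suc))

count-mono : ∀ {n} {f g : Fin n → Bool} → (∀ i → f i ≡ true → g i ≡ true) → count f ≤ count g
count-mono {zero}  _   = z≤n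
count-mono {suc _} f⊆g = ℕP.+-mono-≤ (indicator-mono (f⊆g Fin.zero)) (count-mono (f⊆g ∘ Fin.suc))

count-mono-< : ∀ {n} {f g : Fin n → Bool} → (∀ i → f i ≡ true → g i ≡ true) →
  ∀ j → f j ≡ false → g j ≡ true → count f < count g
count-mono-< f⊆g Fin.zero fj gj rewrite fj | gj = s≤s (count-mono (f⊆g ∘ Fin.suc))
count-mono-< f⊆g (Fin.suc j) fj gj =
  ℕP.+-mono-≤-< (indicator-mono (f⊆g Fin.zero)) (count-mono-< (f⊆g ∘ Fin.suc) j fj gj)

count-update : ∀ {n} {f g : Fin n → Bool} j → (∀ i → i ≢ j → f i ≡ g i) → g j ≡ false →
  count f ≡ indicator (f j) + count g
count-update Fin.zero f≗g gj rewrite gj = cong (_ +_) (count-cong (λ i → f≗g (Fin.suc i) λ ()))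
count-update {f = f} {g} (Fin.suc j) f≗g gj
  rewrite f≗g Fin.zero (λ ())
        | count-update {f = f ∘ Fin.suc} {g ∘ Fin.suc} j (λ i i≢j → f≗g (Fin.suc i) (i≢j ∘ FinP.suc-injective)) gj
  = x∙yz≈y∙xz (indicator (g Fin.zero)) (indicator (f (Fin.suc j))) _

count-false : ∀ {n} → count {n} (const false) ≡ 0
count-false {zero}  = refl
count-false {suc n} = count-false {n}

count≡0⇒false : ∀ {n} (f : Fin n → Bool) → count f ≡ 0 → ∀ i → f i ≡ false
count≡0⇒false {n} f count≡0 i with f i in fi
... | false = refl
... | true with () ← ℕP.<⇒≢ (subst (_< count f) (count-false {n}) (count-mono-< (λ _ ()) i refl fi)) (sym count≡0)

count>0⇒∃ : ∀ {n} (f : Fin n → Bool) → 0 < count f → ∃ λ i → f i ≡ true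
count>0⇒∃ {suc _} f pos with f Fin.zero in f0
... | true  = Fin.zero , f0
... | false with count>0⇒∃ (f ∘ Fin.suc) pos
...   | i , fi = Fin.suc i , fi

count-not+count : ∀ {n} (f : Fin n → Bool) → count (not ∘ f) + count f ≡ n
count-not+count {zero}  f = refl
count-not+count {suc n} f with f Fin.zero
... | true  = trans (ℕP.+-suc _ _) (cong suc (count-not+count (f ∘ Fin.suc)))
... | false = cong suc (count-not+count (f ∘ Fin.suc))

∣p∣≡count-lookup : ∀ {n} (p : Subset n) → ∣ p ∣ ≡ count (lookup p)
∣p∣≡count-lookup []ᵛ          = refl
∣p∣≡count-lookup (true  ∷ᵛ p) = cong suc (∣p∣≡count-lookup p)
∣p∣≡count-lookup (false ∷ᵛ p) = ∣p∣≡count-lookup p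

countL : ∀ {A : Set} → (A → Bool) → List A → ℕ
countL p []       = 0
countL p (x ∷ xs) = indicator (p x) + countL p xs

module _ {A : Set} (p : A → Bool) where

  countL-↭ : ∀ {xs ys} → xs ↭ ys → countL p xs ≡ countL p ys
  countL-↭ Perm.refl         = refl
  countL-↭ (Perm.prep x r)   = cong (indicator (p x) +_) (countL-↭ r)
  countL-↭ (Perm.swap x y r) =
    trans (x∙yz≈y∙xz (indicator (p x)) (indicator (p y)) _)
          (cong (λ c → indicator (p y) + (indicator (p x) + c)) (countL-↭ r))
  countL-↭ (Perm.trans r s)  = trans (countL-↭ r) (countL-↭ s)

  countL-++ : ∀ xs ys → countL p (xs ++ ys) ≡ countL p xs + countL p ys
  countL-++ []       ys = refl
  countL-++ (x ∷ xs) ys =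
    trans (cong (indicator (p x) +_) (countL-++ xs ys)) (sym (ℕP.+-assoc (indicator (p x)) _ _))

  countL≤length : ∀ xs → countL p xs ≤ length xs
  countL≤length []       = z≤n
  countL≤length (x ∷ xs) = ℕP.+-mono-≤ (indicator-mono {p x} (const refl)) (countL≤length xs)

  countL-filterᵇ : ∀ (q : A → Bool) xs → countL p (filterᵇ q xs) ≡ countL (λ x → q x ∧ p x) xs
  countL-filterᵇ q []       = refl
  countL-filterᵇ q (x ∷ xs) with q x
  ... | true  = cong (indicator (p x) +_) (countL-filterᵇ q xs)
  ... | false = countL-filterᵇ q xs

  length-filterᵇ : ∀ xs → length (filterᵇ p xs) ≡ countL p xs
  length-filterᵇ []       = refl
  length-filterᵇ (x ∷ xs) with p x
  ... | true  = cong suc (length-filterᵇ xs)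
  ... | false = length-filterᵇ xs

countL-map : ∀ {A B : Set} (p : B → Bool) (f : A → B) xs → countL p (map f xs) ≡ countL (p ∘ f) xs
countL-map p f []       = refl
countL-map p f (x ∷ xs) = cong (indicator (p (f x)) +_) (countL-map p f xs)

countL-mono : ∀ {A : Set} (p p′ : A → Bool) xs →
  (∀ x → x ∈ xs → p x ≡ true → p′ x ≡ true) → countL p xs ≤ countL p′ xs
countL-mono p p′ []       _    = z≤n
countL-mono p p′ (x ∷ xs) p⊆p′ =
  ℕP.+-mono-≤ (indicator-mono (p⊆p′ x (here refl))) (countL-mono p p′ xs (λ y → p⊆p′ y ∘ there))

countL-cong : ∀ {A : Set} (p p′ : A → Bool) xs → (∀ x → x ∈ xs → p x ≡ p′ x) → countL p xs ≡ countL p′ xs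
countL-cong p p′ xs p≗p′ = ℕP.≤-antisym
  (countL-mono p p′ xs (λ x x∈ px → trans (sym (p≗p′ x x∈)) px))
  (countL-mono p′ p xs (λ x x∈ px → trans (p≗p′ x x∈) px))

countL-false : ∀ {A : Set} (xs : List A) → countL (const false) xs ≡ 0
countL-false []       = refl
countL-false (x ∷ xs) = countL-false xs

allFin-suc : ∀ n → allFin (suc n) ≡ Fin.zero ∷ map Fin.suc (allFin n)
allFin-suc n = cong (Fin.zero ∷_) (sym (ListP.map-tabulate (λ i → i) Fin.suc))

count≡countL-allFin : ∀ {n} (f : Fin n → Bool) → count f ≡ countL f (allFin n)
count≡countL-allFin {zero}  f = refl
count≡countL-allFin {suc n} f = begin
  indicator (f Fin.zero) + count (f ∘ Fin.suc)
    ≡⟨ cong (indicator (f Fin.zero) +_) (count≡countL-allFin (f ∘ Fin.suc)) ⟩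
  indicator (f Fin.zero) + countL (f ∘ Fin.suc) (allFin n)
    ≡⟨ cong (indicator (f Fin.zero) +_) (sym (countL-map f Fin.suc (allFin n))) ⟩
  indicator (f Fin.zero) + countL f (map Fin.suc (allFin n))
    ≡⟨ cong (countL f) (sym (allFin-suc n)) ⟩
  countL f (allFin (suc n))
    ∎
  where open ≡-Reasoning

module _ {m : ℕ} where

  toℕ-csucc : (i : Fin (suc m)) → toℕ i < m → toℕ (csucc i) ≡ suc (toℕ i)
  toℕ-csucc i i<m = trans (FinP.toℕ-fromℕ< _) (m<n⇒m%n≡m (s≤s i<m))

  csucc-last : (i : Fin (suc m)) → toℕ i ≡ m → csucc i ≡ Fin.zero
  csucc-last i i≡m = FinP.toℕ-injective
    (trans (FinP.toℕ-fromℕ< _) (trans (cong (λ z → suc z % suc m) i≡m) (n%n≡0 (suc m))))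

  toℕ-csucc-< : ∀ {i g : Fin (suc m)} → toℕ i < toℕ g → toℕ (csucc i) ≡ suc (toℕ i)
  toℕ-csucc-< {i} {g} i<g = toℕ-csucc i (ℕP.<-≤-trans i<g (FinP.toℕ≤pred[n] g))

  toℕ-csucc-+ : ∀ k (i : Fin (suc m)) → toℕ i + suc (suc k) ≡ suc m → toℕ (csucc i) ≡ suc (toℕ i)
  toℕ-csucc-+ k i i+k≡ = toℕ-csucc i (subst (toℕ i <_)
    (ℕP.suc-injective (trans (sym (ℕP.+-suc (toℕ i) (suc k))) i+k≡)) (ℕP.m<m+n (toℕ i) (s≤s z≤n)))

  fuel-split : (x : Fin (suc m)) → suc m ≡ (suc m ∸ toℕ x) + toℕ x
  fuel-split x = sym (ℕP.m∸n+n≡m (FinP.toℕ≤n x))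

  fuel-split′ : (x : Fin (suc m)) → suc m ≡ suc (toℕ x) + (m ∸ toℕ x)
  fuel-split′ x = cong suc (sym (ℕP.m+[n∸m]≡n (FinP.toℕ≤pred[n] x)))

  ∸-step : ∀ {i g f} → i < g → g ∸ i < suc f → g ∸ suc i < f
  ∸-step {i} {g} {f} i<g lt = subst (_≤ f) (ℕP.+-∸-assoc 1 i<g) (ℕP.≤-pred lt)

  module _ (ok : Fin (suc m) → Bool) where

    searchRight-sound : ∀ fuel i r → searchRight ok i fuel ≡ just r → ok r ≡ true
    searchRight-sound (suc f) i r found with ok i in oki
    ... | true with refl ← found = oki
    ... | false = searchRight-sound f (csucc i) r found

    searchLeft-sound : ∀ fuel i r → searchLeft ok i fuel ≡ just r → ok r ≡ true
    searchLeft-sound (suc f) i r found with ok i in oki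
    ... | true with refl ← found = oki
    ... | false = searchLeft-sound f (cpred i) r found

    searchRight-reaches : ∀ fuel (i g : Fin (suc m)) → ok g ≡ true → toℕ i ≤ toℕ g → toℕ g ∸ toℕ i < fuel →
      ∃ λ r → searchRight ok i fuel ≡ just r × toℕ i ≤ toℕ r × toℕ r ≤ toℕ g
    searchRight-reaches (suc f) i g okg i≤g g∸i<fuel with ok i in oki
    ... | true = i , refl , ℕP.≤-refl , i≤g
    ... | false with ℕP.m≤n⇒m<n∨m≡n i≤g
    ...   | inj₂ i≡g with refl ← FinP.toℕ-injective i≡g with () ← trans (sym oki) okg
    ...   | inj₁ i<g
      with r , found , i′≤r , r≤g ← searchRight-reaches f (csucc i) g okg
             (subst (_≤ toℕ g) (sym (toℕ-csucc-< i<g)) i<g)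
             (subst (λ z → toℕ g ∸ z < f) (sym (toℕ-csucc-< i<g)) (∸-step i<g g∸i<fuel))
      = r , found , ℕP.≤-trans (ℕP.n≤1+n _) (subst (_≤ toℕ r) (toℕ-csucc-< i<g) i′≤r) , r≤g

    searchLeft-reaches : ∀ fuel (i g : Fin (suc m)) → ok g ≡ true → toℕ g ≤ toℕ i → toℕ i ∸ toℕ g < fuel →
      ∃ λ r → searchLeft ok i fuel ≡ just r
    searchLeft-reaches (suc f) i g okg g≤i i∸g<fuel with ok i in oki
    ... | true = i , refl
    ... | false with ℕP.m≤n⇒m<n∨m≡n g≤i
    ...   | inj₂ g≡i with refl ← FinP.toℕ-injective g≡i with () ← trans (sym oki) okg
    ...   | inj₁ g<i with i
    ...     | Fin.suc j rewrite sym (FinP.toℕ-inject₁ j) =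
      searchLeft-reaches f (inject₁ j) g okg (ℕP.≤-pred g<i) (∸-step g<i i∸g<fuel)

    searchRight-wraps : ∀ k (i : Fin (suc m)) f′ → toℕ i + k ≡ suc m →
      (∃ λ r → searchRight ok i (k + f′) ≡ just r × toℕ i ≤ toℕ r) ⊎
      (searchRight ok i (k + f′) ≡ searchRight ok Fin.zero f′)
    searchRight-wraps zero i f′ i+0≡ with () ← ℕP.<⇒≢ (FinP.toℕ<n i) (trans (sym (ℕP.+-identityʳ (toℕ i))) i+0≡)
    searchRight-wraps (suc zero) i f′ i+1≡ with ok i
    ... | true  = inj₁ (i , refl , ℕP.≤-refl)
    ... | false = inj₂ (cong (λ z → searchRight ok z f′)
                    (csucc-last i (ℕP.suc-injective (trans (ℕP.+-comm 1 (toℕ i)) i+1≡))))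
    searchRight-wraps (suc (suc k)) i f′ i+k≡
      with ok i | searchRight-wraps (suc k) (csucc i) f′
                    (trans (cong (_+ suc k) (toℕ-csucc-+ k i i+k≡)) (trans (sym (ℕP.+-suc (toℕ i) (suc k))) i+k≡))
    ... | true  | _                       = inj₁ (i , refl , ℕP.≤-refl)
    ... | false | inj₂ wrapped            = inj₂ wrapped
    ... | false | inj₁ (r , found , i′≤r) =
      inj₁ (r , found , ℕP.≤-trans (ℕP.n≤1+n _) (subst (_≤ toℕ r) (toℕ-csucc-+ k i i+k≡) i′≤r))

    searchLeft-wraps : ∀ a (i : Fin (suc m)) f′ → toℕ i ≡ a →
      (∃ λ r → searchLeft ok i (suc a + f′) ≡ just r) ⊎
      (searchLeft ok i (suc a + f′) ≡ searchLeft ok (fromℕ m) f′)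
    searchLeft-wraps zero Fin.zero f′ _ with ok Fin.zero
    ... | true  = inj₁ (Fin.zero , refl)
    ... | false = inj₂ refl
    searchLeft-wraps (suc a) (Fin.suc j) f′ j+1≡a+1
      with ok (Fin.suc j) | searchLeft-wraps a (inject₁ j) f′ (trans (FinP.toℕ-inject₁ j) (ℕP.suc-injective j+1≡a+1))
    ... | true  | _      = inj₁ (Fin.suc j , refl)
    ... | false | result = result

InCyclicInterval : ∀ {n} → Fin n → Fin n → Fin n → Set
InCyclicInterval x g r = (x Fin.≤ r × r Fin.≤ g) ⊎ (g Fin.< x × (x Fin.≤ r ⊎ r Fin.≤ g))

firstRight-sound : ∀ {n} (ok : Fin n → Bool) x r → firstRight ok x ≡ just r → ok r ≡ true
firstRight-sound {suc m} ok x r = searchRight-sound ok (suc m) x r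

firstLeft-sound : ∀ {n} (ok : Fin n → Bool) x r → firstLeft ok x ≡ just r → ok r ≡ true
firstLeft-sound {suc m} ok x r = searchLeft-sound ok (suc m) x r

firstRight-inInterval : ∀ {n} (ok : Fin n → Bool) (x g : Fin n) → ok g ≡ true →
  ∃ λ r → firstRight ok x ≡ just r × InCyclicInterval x g r
firstRight-inInterval {suc m} ok x g okg with toℕ x ℕ.≤? toℕ g
... | yes x≤g
  with r , found , x≤r , r≤g ← searchRight-reaches ok (suc m) x g okg x≤g
                                 (s≤s (ℕP.≤-trans (ℕP.m∸n≤m (toℕ g) (toℕ x)) (FinP.toℕ≤pred[n] g)))
  = r , found , inj₁ (x≤r , r≤g)
... | no x≰g with searchRight-wraps ok (suc m ∸ toℕ x) x (toℕ x) (ℕP.m+[n∸m]≡n (FinP.toℕ≤n x))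
...   | inj₁ (r , found , x≤r) =
  r , trans (cong (searchRight ok x) (fuel-split x)) found , inj₂ (ℕP.≰⇒> x≰g , inj₁ x≤r)
...   | inj₂ restart
  with r , found , _ , r≤g ← searchRight-reaches ok (toℕ x) Fin.zero g okg z≤n (ℕP.≰⇒> x≰g)
  = r , trans (cong (searchRight ok x) (fuel-split x)) (trans restart found) , inj₂ (ℕP.≰⇒> x≰g , inj₂ r≤g)

firstRight∈interval : ∀ {n} (ok : Fin n → Bool) (x g r : Fin n) → ok g ≡ true → firstRight ok x ≡ just r →
  InCyclicInterval x g r
firstRight∈interval ok x g r okg found with r′ , found′ , between ← firstRight-inInterval ok x g okg
  with refl ← trans (sym found) found′ = between

firstRight-complete : ∀ {n} (ok : Fin n → Bool) (x g : Fin n) → ok g ≡ true → ∃ λ r → firstRight ok x ≡ just r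
firstRight-complete ok x g okg with r , found , _ ← firstRight-inInterval ok x g okg = r , found

firstLeft-complete : ∀ {n} (ok : Fin n → Bool) (x g : Fin n) → ok g ≡ true → ∃ λ r → firstLeft ok x ≡ just r
firstLeft-complete {suc m} ok x g okg with toℕ g ℕ.≤? toℕ x
... | yes g≤x =
  searchLeft-reaches ok (suc m) x g okg g≤x (s≤s (ℕP.≤-trans (ℕP.m∸n≤m (toℕ x) (toℕ g)) (FinP.toℕ≤pred[n] x)))
... | no g≰x with searchLeft-wraps ok (toℕ x) x (m ∸ toℕ x) refl
...   | inj₁ found = subst (λ fuel → ∃ λ r → searchLeft ok x fuel ≡ just r) (sym (fuel-split′ x)) found
...   | inj₂ restart
  with r , found ← searchLeft-reaches ok (m ∸ toℕ x) (fromℕ m) g okg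
                     (subst (toℕ g ≤_) (sym (FinP.toℕ-fromℕ m)) (FinP.toℕ≤pred[n] g))
                     (subst (λ z → z ∸ toℕ g < m ∸ toℕ x) (sym (FinP.toℕ-fromℕ m))
                            (ℕP.∸-monoʳ-< (ℕP.≰⇒> g≰x) (FinP.toℕ≤pred[n] g)))
  = r , trans (cong (searchLeft ok x) (fuel-split′ x)) (trans restart found)

is-nothing⇒≡nothing : ∀ {A : Set} {m : Maybe A} → is-nothing m ≡ true → m ≡ nothing
is-nothing⇒≡nothing {m = nothing} _ = refl

setAt-same : ∀ {n} (v : PWord n) j x → setAt v j x j ≡ just x
setAt-same v j x with j Fin.≟ j
... | yes _   = refl
... | no j≢j = contradiction refl j≢j

setAt-other : ∀ {n} (v : PWord n) j x k → k ≢ j → setAt v j x k ≡ v k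
setAt-other v j x k k≢j with j Fin.≟ k
... | yes refl = contradiction refl k≢j
... | no _     = refl

module GreedyFill {n} (select : (Fin n → Bool) → Fin n → Maybe (Fin n))
  (select-sound : ∀ ok x r → select ok x ≡ just r → ok r ≡ true)
  (select-complete : ∀ ok x g → ok g ≡ true → ∃ λ r → select ok x ≡ just r)
  (allowed : Fin n → Bool) (value : Fin n → ℕ) where

  free : PWord n → Fin n → Bool
  free v j = allowed j ∧ is-nothing (v j)

  fill : List (Fin n) → PWord n → PWord n
  fill []       v = v
  fill (i ∷ xs) v with select (free v) i
  ... | just j  = fill xs (setAt v j (value i))
  ... | nothing = fill xs v

  -- (i , j) ∈ placements xs v: the value of site i was written at site j.
  placements : List (Fin n) → PWord n → List (Fin n × Fin n)
  placements []       v = []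
  placements (i ∷ xs) v with select (free v) i
  ... | just j  = (i , j) ∷ placements xs (setAt v j (value i))
  ... | nothing = placements xs v

  free⇒empty : ∀ v {j} → free v j ≡ true → v j ≡ nothing
  free⇒empty v {j} = is-nothing⇒≡nothing ∘ ∧-conicalʳ (allowed j) _

  free⇒allowed : ∀ v {j} → free v j ≡ true → allowed j ≡ true
  free⇒allowed v {j} = ∧-conicalˡ (allowed j) _

  selected-free : ∀ v {i j} → select (free v) i ≡ just j → free v j ≡ true
  selected-free v {i} {j} = select-sound (free v) i j

  setAt-free-keeps : ∀ v j x g c → free v j ≡ true → v g ≡ just c → setAt v j x g ≡ just c
  setAt-free-keeps v j x g c freej vg with j Fin.≟ g
  ... | no _     = vg
  ... | yes refl with () ← trans (sym (free⇒empty v freej)) vg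

  fill-keeps : ∀ xs v g c → v g ≡ just c → fill xs v g ≡ just c
  fill-keeps []       v g c vg = vg
  fill-keeps (i ∷ xs) v g c vg with select (free v) i in sel
  ... | just j  = fill-keeps xs _ g c (setAt-free-keeps v j (value i) g c (selected-free v sel) vg)
  ... | nothing = fill-keeps xs v g c vg

  fill-disallowed : ∀ xs v g → allowed g ≡ false → fill xs v g ≡ v g
  fill-disallowed []       v g _   = refl
  fill-disallowed (i ∷ xs) v g ¬ag with select (free v) i in sel
  ... | nothing = fill-disallowed xs v g ¬ag
  ... | just j  = trans (fill-disallowed xs _ g ¬ag) (setAt-other v j (value i) g g≢j)
    where
    g≢j : g ≢ j
    g≢j refl with () ← trans (sym ¬ag) (free⇒allowed v (selected-free v sel))

  placement-value : ∀ xs v {x r} → (x , r) ∈ placements xs v →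
    allowed r ≡ true × fill xs v r ≡ just (value x)
  placement-value (i ∷ xs) v x↦r with select (free v) i in sel
  placement-value (i ∷ xs) v x↦r         | nothing = placement-value xs v x↦r
  placement-value (i ∷ xs) v (here refl) | just j  =
    free⇒allowed v (selected-free v sel) , fill-keeps xs _ j (value i) (setAt-same v j (value i))
  placement-value (i ∷ xs) v (there x↦r) | just j  = placement-value xs _ x↦r

  placement-source : ∀ xs v g c → fill xs v g ≡ just c → v g ≡ nothing →
    ∃ λ x → (x , g) ∈ placements xs v × c ≡ value x
  placement-source []       v g c filled empty with () ← trans (sym filled) empty
  placement-source (i ∷ xs) v g c filled empty with select (free v) i in sel
  ... | nothing with x , x↦g , c≡ ← placement-source xs v g c filled empty = x , x↦g , c≡
  ... | just j with j Fin.≟ g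
  ...   | yes refl = i , here refl , just-injective (trans (sym filled) (fill-keeps xs _ j (value i) (setAt-same v j (value i))))
  ...   | no j≢g with x , x↦g , c≡ ← placement-source xs _ g c filled (trans (setAt-other v j (value i) g (j≢g ∘ sym)) empty)
    = x , there x↦g , c≡

  count-free-setAt : ∀ v j x → free v j ≡ true → count (free v) ≡ suc (count (free (setAt v j x)))
  count-free-setAt v j x freej =
    trans (count-update j (λ k k≢j → cong (λ z → allowed k ∧ is-nothing z) (sym (setAt-other v j x k k≢j)))
                          (trans (cong (λ z → allowed j ∧ is-nothing z) (setAt-same v j x)) (∧-zeroʳ (allowed j))))
          (cong (λ b → indicator b + count (free (setAt v j x))) freej)

  fill-total : ∀ xs v → count (free v) ≡ length xs →
    map proj₁ (placements xs v) ≡ xs × (∀ g → allowed g ≡ true → ∃ λ c → fill xs v g ≡ just c)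
  fill-total [] v none-free = refl , filled
    where
    filled : ∀ g → allowed g ≡ true → ∃ λ c → v g ≡ just c
    filled g ag with v g in vg
    ... | just c  = c , refl
    ... | nothing with () ← trans (sym (count≡0⇒false (free v) none-free g)) (cong₂ _∧_ ag (cong is-nothing vg))
  fill-total (i ∷ xs) v count≡ with g , freeg ← count>0⇒∃ (free v) (subst (0 <_) (sym count≡) (s≤s z≤n))
                                 with select (free v) i in sel
  ... | nothing with () ← trans (sym (proj₂ (select-complete (free v) i g freeg))) sel
  ... | just j with sources , filled ← fill-total xs (setAt v j (value i))
                                          (ℕP.suc-injective (trans (sym (count-free-setAt v j (value i) (selected-free v sel))) count≡))
    = cong (i ∷_) sources , filled

  count-fill : ∀ (Φ : Maybe ℕ → Fin n → Bool) → (∀ g → Φ nothing g ≡ false) → ∀ xs v →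
    count (λ g → Φ (fill xs v g) g) ≡
    count (λ g → Φ (v g) g) + countL (λ (x , r) → Φ (just (value x)) r) (placements xs v)
  count-fill Φ Φ-nothing []       v = sym (ℕP.+-identityʳ _)
  count-fill Φ Φ-nothing (i ∷ xs) v with select (free v) i in sel
  ... | nothing = count-fill Φ Φ-nothing xs v
  ... | just j  = begin
    count (λ g → Φ (fill xs v′ g) g)                    ≡⟨ count-fill Φ Φ-nothing xs v′ ⟩
    count (λ g → Φ (v′ g) g) + rest                     ≡⟨ cong (_+ rest) new-site ⟩
    (indicator (Φ (just (value i)) j) + count (λ g → Φ (v g) g)) + rest
                                                        ≡⟨ xy∙z≈y∙xz (indicator (Φ (just (value i)) j)) _ rest ⟩
    count (λ g → Φ (v g) g) + (indicator (Φ (just (value i)) j) + rest) ∎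
    where
    open ≡-Reasoning
    v′ : PWord n
    v′ = setAt v j (value i)
    rest : ℕ
    rest = countL (λ (x , r) → Φ (just (value x)) r) (placements xs v′)
    new-site : count (λ g → Φ (v′ g) g) ≡ indicator (Φ (just (value i)) j) + count (λ g → Φ (v g) g)
    new-site = trans
      (count-update j (λ k k≢j → cong (λ z → Φ z k) (setAt-other v j (value i) k k≢j))
                      (trans (cong (λ z → Φ z j) (free⇒empty v (selected-free v sel))) (Φ-nothing j)))
      (cong (λ z → indicator (Φ z j) + _) (setAt-same v j (value i)))

  -- Letters are placed in increasing order of value, so an allowed site whose final value
  -- exceeds the value of x was still free when x was placed.
  placement-greedy : ∀ xs v → AllPairs (λ a b → value a ≤ value b) xs →
    (∀ g c → allowed g ≡ true → v g ≡ just c → All (λ y → c ≤ value y) xs) →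
    ∀ {x r} → (x , r) ∈ placements xs v →
    ∃ λ ok → select ok x ≡ just r ×
             (∀ g → allowed g ≡ true → (∀ c → fill xs v g ≡ just c → value x < c) → ok g ≡ true)
  placement-greedy (i ∷ xs) v (_ ∷ sorted) early x↦r with select (free v) i in sel
  placement-greedy (i ∷ xs) v (_ ∷ sorted) early x↦r | nothing =
    placement-greedy xs v sorted (λ g c ag vg → All.tail (early g c ag vg)) x↦r
  placement-greedy (i ∷ xs) v (_ ∷ sorted) early (here refl) | just j = free v , sel , still-free
    where
    still-free : ∀ g → allowed g ≡ true → (∀ c → fill xs (setAt v j (value i)) g ≡ just c → value i < c) →
                 free v g ≡ true
    still-free g ag exceeds with v g in vg
    ... | nothing rewrite ag = refl
    ... | just c with c≤i ∷ _ ← early g c ag vg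
      with () ← ℕP.<⇒≱ (exceeds c (fill-keeps xs _ g c (setAt-free-keeps v j (value i) g c (selected-free v sel) vg))) c≤i
  placement-greedy (i ∷ xs) v (i≤xs ∷ sorted) early (there x↦r) | just j =
    placement-greedy xs (setAt v j (value i)) sorted early′ x↦r
    where
    early′ : ∀ g c → allowed g ≡ true → setAt v j (value i) g ≡ just c → All (λ y → c ≤ value y) xs
    early′ g c ag vg with j Fin.≟ g
    early′ g c ag refl | yes refl = i≤xs
    early′ g c ag vg   | no _ with _ ∷ cs ← early g c ag vg = cs

atLeast : ∀ {n} → ℕ → Fin n → Bool
atLeast c g = ⌊ c ≤? toℕ g ⌋

Ascending : ∀ {n} → List (Fin n) → Set
Ascending = AllPairs Fin._<_

module _ {n : ℕ} where

  indicator-atLeast-≤ : ∀ {c} {g : Fin n} → c ≤ toℕ g → indicator (atLeast c g) ≡ 1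
  indicator-atLeast-≤ {c} {g} c≤g = cong indicator (⌊⌋≡true (c ≤? toℕ g) c≤g)

  indicator-atLeast-> : ∀ {c} {g : Fin n} → toℕ g < c → indicator (atLeast c g) ≡ 0
  indicator-atLeast-> {c} {g} g<c = cong indicator (⌊⌋≡false (c ≤? toℕ g) (ℕP.<⇒≱ g<c))

  countL-atLeast-all : ∀ {c} (zs : List (Fin n)) → All (λ b → c ≤ toℕ b) zs → countL (atLeast c) zs ≡ length zs
  countL-atLeast-all []       _            = refl
  countL-atLeast-all (z ∷ zs) (c≤z ∷ c≤zs) = cong₂ _+_ (indicator-atLeast-≤ c≤z) (countL-atLeast-all zs c≤zs)

  all≥-from-all> : ∀ {c} {x : Fin n} {zs : List (Fin n)} → c ≤ toℕ x → All (x Fin.<_) zs → All (λ b → c ≤ toℕ b) zs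
  all≥-from-all> c≤x = All.map (λ x<b → ℕP.≤-trans c≤x (ℕP.<⇒≤ x<b))

  -- If y > x, counting the elements ≥ x + 1 gives 1 + |ys| on the right and at most |xs| on the left.
  tailCounts⇒pointwise-≥ : ∀ (xs ys : List (Fin n)) → Ascending xs → Ascending ys → length xs ≡ length ys →
    (∀ c → countL (atLeast c) ys ≤ countL (atLeast c) xs) → Pointwise (λ a b → b Fin.≤ a) xs ys
  tailCounts⇒pointwise-≥ []       []       _                _                _   _     = []
  tailCounts⇒pointwise-≥ (x ∷ xs) (y ∷ ys) (x<xs ∷ asc-xs) (y<ys ∷ asc-ys) len tails =
    y≤x ∷ tailCounts⇒pointwise-≥ xs ys asc-xs asc-ys (ℕP.suc-injective len) tails′
    where
    |xs|≡|ys| : length xs ≡ length ys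
    |xs|≡|ys| = ℕP.suc-injective len

    y≤x : y Fin.≤ x
    y≤x with toℕ y ≤? toℕ x
    ... | yes y≤x = y≤x
    ... | no y≰x = contradiction (tails (suc (toℕ x))) (ℕP.<⇒≱ (begin-strict
      indicator (atLeast c x) + countL (atLeast c) xs  ≡⟨ cong (_+ countL (atLeast c) xs)
                                                            (indicator-atLeast-> (ℕP.n<1+n (toℕ x))) ⟩
      countL (atLeast c) xs                            ≤⟨ countL≤length _ xs ⟩
      length xs                                        ≡⟨ |xs|≡|ys| ⟩
      length ys                                        <⟨ ℕP.n<1+n _ ⟩
      1 + length ys                                    ≡⟨ cong₂ _+_ (sym (indicator-atLeast-≤ x<y))
                                                            (sym (countL-atLeast-all ys (all≥-from-all> x<y y<ys))) ⟩
      indicator (atLeast c y) + countL (atLeast c) ys  ∎))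
      where
      open ℕP.≤-Reasoning
      c : ℕ
      c = suc (toℕ x)
      x<y : x Fin.< y
      x<y = ℕP.≰⇒> y≰x

    tails′ : ∀ c → countL (atLeast c) ys ≤ countL (atLeast c) xs
    tails′ c with c ≤? toℕ y | c ≤? toℕ x
    ... | yes c≤y | yes c≤x = ℕP.≤-pred (subst₂ _≤_ (cong (_+ _) (indicator-atLeast-≤ c≤y))
                                                    (cong (_+ _) (indicator-atLeast-≤ c≤x)) (tails c))
    ... | yes c≤y | no c≰x  = contradiction (ℕP.≤-trans c≤y y≤x) c≰x
    ... | no c≰y  | no c≰x  = subst₂ _≤_ (cong (_+ _) (indicator-atLeast-> (ℕP.≰⇒> c≰y)))
                                          (cong (_+ _) (indicator-atLeast-> (ℕP.≰⇒> c≰x))) (tails c)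
    ... | no _    | yes c≤x = subst (countL (atLeast c) ys ≤_)
                                    (sym (trans (countL-atLeast-all xs (all≥-from-all> c≤x x<xs)) |xs|≡|ys|))
                                    (countL≤length _ ys)

  ⪰-fromTailCounts : ∀ (A B : Subset n) → count (lookup A) ≡ count (lookup B) →
    (∀ c → count (λ g → lookup B g ∧ atLeast c g) ≤ count (λ g → lookup A g ∧ atLeast c g)) → A ⪰ B
  ⪰-fromTailCounts A B |A|≡|B| tails = Pointwise.reverse⁺
    (tailCounts⇒pointwise-≥ _ _ (ascending A) (ascending B)
      (trans (length-elems A) (trans |A|≡|B| (sym (length-elems B))))
      (λ c → subst₂ _≤_ (tailCount B c) (tailCount A c) (tails c)))
    where
    elems : Subset n → List (Fin n)
    elems A = filterᵇ (lookup A) (allFin n)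
    ascending : ∀ A → Ascending (elems A)
    ascending A = AllPairsP.filter⁺ _ (AllPairsP.tabulate⁺-< (λ i<j → i<j))
    length-elems : ∀ A → length (elems A) ≡ count (lookup A)
    length-elems A = trans (length-filterᵇ (lookup A) (allFin n)) (sym (count≡countL-allFin (lookup A)))
    tailCount : ∀ A c → count (λ g → lookup A g ∧ atLeast c g) ≡ countL (atLeast c) (elems A)
    tailCount A c = trans (count≡countL-allFin (λ g → lookup A g ∧ atLeast c g))
                          (sym (countL-filterᵇ (atLeast c) (lookup A) (allFin n)))

∈-drop : ∀ {A : Set} k (xs : List A) {b} → b ∈ drop k xs → b ∈ xs
∈-drop zero    xs       b∈ = b∈
∈-drop (suc k) (x ∷ xs) b∈ = there (∈-drop k xs b∈)

AllPairs-take-drop : ∀ {A : Set} {R : A → A → Set} k {xs : List A} → AllPairs R xs →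
  ∀ {a b} → a ∈ take k xs → b ∈ drop k xs → R a b
AllPairs-take-drop (suc k) {x ∷ xs} (x~xs ∷ _)    (here refl) b∈ = All.lookup x~xs (∈-drop k xs b∈)
AllPairs-take-drop (suc k) {x ∷ xs} (_ ∷ sorted) (there a∈)  b∈ = AllPairs-take-drop k sorted a∈ b∈

lookup-levelSet : ∀ {n} (w : Word n) h g → lookup (levelSet w h) g ≡ ⌊ w g ≟ h ⌋
lookup-levelSet w h = VecP.lookup∘tabulate (λ p → ⌊ w p ≟ h ⌋)

∈levelSet⇒ : ∀ {n} (w : Word n) h g → lookup (levelSet w h) g ≡ true → w g ≡ h
∈levelSet⇒ w h g g∈ = ⌊⌋≡true⇒ (w g ≟ h) (trans (sym (lookup-levelSet w h g)) g∈)

module QueueAction {n} (q : Queue n) (u : Word n) (is : List (Fin n))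
  (is↭ : is ↭ allFin n) (sorted : Linked (λ i j → u i ≤ u j) is) where

  w : Word n
  w = queueAct q u is

  -- low: the ∣ q ∣ sites with the smallest letters, written in Phase II; high: the others.
  low high : List (Fin n)
  low  = take ∣ q ∣ is
  high = drop ∣ q ∣ is

  module PhaseI  = GreedyFill firstLeft firstLeft-sound firstLeft-complete (not ∘ lookup q) (suc ∘ u)
  module PhaseII = GreedyFill firstRight firstRight-sound firstRight-complete (lookup q) u

  phaseI≡fill : ∀ xs v → phaseI q u xs v ≡ PhaseI.fill xs v
  phaseI≡fill []       v = refl
  phaseI≡fill (i ∷ xs) v with firstLeft (PhaseI.free v) i
  ... | just j  = phaseI≡fill xs _
  ... | nothing = phaseI≡fill xs v

  phaseII≡fill : ∀ xs v → phaseII q u xs v ≡ PhaseII.fill xs v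
  phaseII≡fill []       v = refl
  phaseII≡fill (i ∷ xs) v with firstRight (PhaseII.free v) i
  ... | just j  = phaseII≡fill xs _
  ... | nothing = phaseII≡fill xs v

  afterPhaseI afterPhaseII : PWord n
  afterPhaseI = PhaseI.fill (reverse high) (const nothing)
  afterPhaseII = PhaseII.fill low afterPhaseI

  w≡afterPhaseII : ∀ p → w p ≡ fromMaybe 0 (afterPhaseII p)
  w≡afterPhaseII p rewrite phaseI≡fill (reverse high) (const nothing) | phaseII≡fill low afterPhaseI = refl

  placedI placedII : List (Fin n × Fin n)
  placedI  = PhaseI.placements (reverse high) (const nothing)
  placedII = PhaseII.placements low afterPhaseI

  length-is : length is ≡ n
  length-is = trans (PermP.↭-length is↭) (ListP.length-tabulate (λ i → i))

  length-low : length low ≡ ∣ q ∣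
  length-low = trans (ListP.length-take ∣ q ∣ is)
                     (trans (cong (∣ q ∣ ℕ.⊓_) length-is) (ℕP.m≤n⇒m⊓n≡m (SubsetP.∣p∣≤n q)))

  length-high : length (reverse high) ≡ n ∸ ∣ q ∣
  length-high = trans (ListP.length-reverse high) (trans (ListP.length-drop ∣ q ∣ is) (cong (_∸ ∣ q ∣) length-is))

  afterPhaseI-q : ∀ g → lookup q g ≡ true → afterPhaseI g ≡ nothing
  afterPhaseI-q g qg = PhaseI.fill-disallowed (reverse high) (const nothing) g (cong not qg)

  freeSites-I : count (PhaseI.free (const nothing)) ≡ length (reverse high)
  freeSites-I = begin
    count (λ j → not (lookup q j) ∧ true)      ≡⟨ count-cong (λ j → ∧-identityʳ (not (lookup q j))) ⟩
    count (not ∘ lookup q)                     ≡⟨ sym (ℕP.m+n∸n≡m _ (count (lookup q))) ⟩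
    count (not ∘ lookup q) + count (lookup q) ∸ count (lookup q)
                                               ≡⟨ cong₂ _∸_ (count-not+count (lookup q)) (sym (∣p∣≡count-lookup q)) ⟩
    n ∸ ∣ q ∣                                  ≡⟨ sym length-high ⟩
    length (reverse high)                      ∎
    where open ≡-Reasoning

  freeSites-II : count (PhaseII.free afterPhaseI) ≡ length low
  freeSites-II = trans (count-cong free≗q) (trans (sym (∣p∣≡count-lookup q)) (sym length-low))
    where
    free≗q : ∀ j → PhaseII.free afterPhaseI j ≡ lookup q j
    free≗q j with lookup q j in qj
    ... | true rewrite afterPhaseI-q j qj = refl
    ... | false = refl

  placedI-sources : map proj₁ placedI ≡ reverse high
  placedI-sources = proj₁ (PhaseI.fill-total (reverse high) (const nothing) freeSites-I)

  placedII-sources : map proj₁ placedII ≡ low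
  placedII-sources = proj₁ (PhaseII.fill-total low afterPhaseI freeSites-II)

  afterPhaseII-total : ∀ g → ∃ λ c → afterPhaseII g ≡ just c
  afterPhaseII-total g with lookup q g in qg
  ... | true  = proj₂ (PhaseII.fill-total low afterPhaseI freeSites-II) g qg
  ... | false with c , afterIg ← proj₂ (PhaseI.fill-total (reverse high) (const nothing) freeSites-I) g (cong not qg)
    = c , trans (PhaseII.fill-disallowed low afterPhaseI g qg) afterIg

  afterPhaseII≡w : ∀ g → afterPhaseII g ≡ just (w g)
  afterPhaseII≡w g with c , afterIIg ← afterPhaseII-total g =
    trans afterIIg (cong just (sym (trans (w≡afterPhaseII g) (cong (fromMaybe 0) afterIIg))))

  afterPhaseI≡w : ∀ g → lookup q g ≡ false → afterPhaseI g ≡ just (w g)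
  afterPhaseI≡w g qg = trans (sym (PhaseII.fill-disallowed low afterPhaseI g qg)) (afterPhaseII≡w g)

  low-or-high : ∀ y → y ∈ low ⊎ y ∈ high
  low-or-high y = ∈P.∈-++⁻ low (subst (y ∈_) (sym (ListP.take++drop≡id ∣ q ∣ is))
                                     (PermP.∈-resp-↭ (↭-sym is↭) (∈P.∈-allFin y)))

  low-sorted : AllPairs (λ a b → u a ≤ u b) low
  low-sorted = AllPairsP.take⁺ ∣ q ∣ (LinkedP.Linked⇒AllPairs ℕP.≤-trans sorted)

  low≤high : ∀ {a b} → a ∈ low → b ∈ high → u a ≤ u b
  low≤high = AllPairs-take-drop ∣ q ∣ (LinkedP.Linked⇒AllPairs ℕP.≤-trans sorted)

  low-placed : ∀ y → y ∈ low → ∃ λ r → (y , r) ∈ placedII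
  low-placed y y∈ with (_ , r) , y↦r , refl ← ∈P.∈-map⁻ proj₁ (subst (y ∈_) (sym placedII-sources) y∈) = r , y↦r

  high-placed : ∀ y → y ∈ high → ∃ λ r → (y , r) ∈ placedI
  high-placed y y∈ with (_ , r) , y↦r , refl ← ∈P.∈-map⁻ proj₁ (subst (y ∈_) (sym placedI-sources) (AnyP.reverse⁺ y∈))
    = r , y↦r

  placedII-value : ∀ {y r} → (y , r) ∈ placedII → lookup q r ≡ true × w r ≡ u y
  placedII-value y↦r with qr , afterIIr ← PhaseII.placement-value low afterPhaseI y↦r
    = qr , just-injective (trans (sym (afterPhaseII≡w _)) afterIIr)

  placedI-value : ∀ {y r} → (y , r) ∈ placedI → lookup q r ≡ false × w r ≡ suc (u y)
  placedI-value {r = r} y↦r with ¬qr , afterIr ← PhaseI.placement-value (reverse high) (const nothing) y↦r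
    = not-injective ¬qr , just-injective (trans (sym (afterPhaseI≡w r (not-injective ¬qr))) afterIr)

  q-site-from-low : ∀ g → lookup q g ≡ true → ∃ λ y → y ∈ low × w g ≡ u y
  q-site-from-low g qg with y , y↦g , wg≡ ← PhaseII.placement-source low afterPhaseI g (w g) (afterPhaseII≡w g) (afterPhaseI-q g qg)
    = y , subst (y ∈_) placedII-sources (∈P.∈-map⁺ proj₁ y↦g) , wg≡

  nonq-site-from-high : ∀ g → lookup q g ≡ false → ∃ λ y → y ∈ high × w g ≡ suc (u y)
  nonq-site-from-high g qg with y , y↦g , wg≡ ← PhaseI.placement-source (reverse high) (const nothing) g (w g) (afterPhaseI≡w g qg) refl
    = y , AnyP.reverse⁻ (subst (y ∈_) placedI-sources (∈P.∈-map⁺ proj₁ y↦g)) , wg≡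

  placedII-greedy : ∀ {x r} → (x , r) ∈ placedII →
    ∃ λ ok → firstRight ok x ≡ just r × (∀ g → lookup q g ≡ true → u x < w g → ok g ≡ true)
  placedII-greedy x↦r =
    let ok , found , ok-big = PhaseII.placement-greedy low afterPhaseI low-sorted nothing-filled x↦r
    in ok , found , λ g qg x<g →
         ok-big g qg (λ c afterIIg → subst (_ <_) (just-injective (trans (sym (afterPhaseII≡w g)) afterIIg)) x<g)
    where
    nothing-filled : ∀ g c → lookup q g ≡ true → afterPhaseI g ≡ just c → All.All (λ y → c ≤ u y) low
    nothing-filled g c qg afterIg with () ← trans (sym (afterPhaseI-q g qg)) afterIg

  module AtMost (t : ℕ) (|atMost|≡|q| : ∣ atMostSet w t ∣ ≡ ∣ q ∣) where

    count-atMost≡count-q : count (λ p → ⌊ w p ≤? t ⌋) ≡ count (lookup q)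
    count-atMost≡count-q = begin
      count (λ p → ⌊ w p ≤? t ⌋)      ≡⟨ count-cong (λ p → sym (VecP.lookup∘tabulate (λ p → ⌊ w p ≤? t ⌋) p)) ⟩
      count (lookup (atMostSet w t))  ≡⟨ sym (∣p∣≡count-lookup (atMostSet w t)) ⟩
      ∣ atMostSet w t ∣               ≡⟨ |atMost|≡|q| ⟩
      ∣ q ∣                           ≡⟨ ∣p∣≡count-lookup q ⟩
      count (lookup q)                ∎
      where open ≡-Reasoning

    -- A letter of low above t would put a site of q above t, while every site at most t lies in q
    -- (the others carry a letter of high plus one): fewer than ∣ q ∣ sites at most t.
    low-≤t : ∀ y → y ∈ low → u y ≤ t
    low-≤t y y∈ = ℕP.≮⇒≥ λ t<y →
      let r , y↦r  = low-placed y y∈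
          qr , wr≡ = placedII-value y↦r
          r>t      = ⌊⌋≡false (w r ≤? t) (ℕP.<⇒≱ (subst (t <_) (sym wr≡) t<y))
      in ℕP.<⇒≢ (count-mono-< (atMost⇒q t<y) r r>t qr) count-atMost≡count-q
      where
      atMost⇒q : t < u y → ∀ p → ⌊ w p ≤? t ⌋ ≡ true → lookup q p ≡ true
      atMost⇒q t<y p wp≤t with lookup q p in qp
      ... | true  = refl
      ... | false with z , z∈ , wp≡ ← nonq-site-from-high p qp =
        contradiction (subst (_≤ t) wp≡ (⌊⌋≡true⇒ (w p ≤? t) wp≤t))
                      (ℕP.<⇒≱ (ℕP.<-≤-trans t<y (ℕP.m≤n⇒m≤1+n (low≤high y∈ z∈))))

    q-site-≤t : ∀ g → lookup q g ≡ true → w g ≤ t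
    q-site-≤t g qg with y , y∈ , wg≡ ← q-site-from-low g qg = subst (_≤ t) (sym wg≡) (low-≤t y y∈)

    nonq-site->t : ∀ p → lookup q p ≡ false → t < w p
    nonq-site->t p qp with w p ≤? t
    ... | no  wp≰t = ℕP.≰⇒> wp≰t
    ... | yes wp≤t =
      contradiction (sym count-atMost≡count-q) (ℕP.<⇒≢ (count-mono-< q⇒atMost p qp (⌊⌋≡true (w p ≤? t) wp≤t)))
      where
      q⇒atMost : ∀ g → lookup q g ≡ true → ⌊ w g ≤? t ⌋ ≡ true
      q⇒atMost g qg = ⌊⌋≡true (w g ≤? t) (q-site-≤t g qg)

    ≤t⇒q-site : ∀ p → w p ≤ t → lookup q p ≡ true
    ≤t⇒q-site p wp≤t with lookup q p in qp
    ... | true  = refl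
    ... | false = contradiction wp≤t (ℕP.<⇒≱ (nonq-site->t p qp))

    high-≥t : ∀ y → y ∈ high → t ≤ u y
    high-≥t y y∈ with r , y↦r ← high-placed y y∈ with ¬qr , wr≡ ← placedI-value y↦r =
      ℕP.≤-pred (subst (t <_) wr≡ (nonq-site->t r ¬qr))

    <t⇒low : ∀ y → u y < t → y ∈ low
    <t⇒low y y<t with low-or-high y
    ... | inj₁ y∈low  = y∈low
    ... | inj₂ y∈high = contradiction (high-≥t y y∈high) (ℕP.<⇒≱ y<t)

    count-level-w : ∀ h → h < t → (θ : Fin n → Bool) →
      count (λ g → lookup (levelSet w h) g ∧ θ g) ≡ countL (λ (x , r) → ⌊ u x ≟ h ⌋ ∧ θ r) placedII
    count-level-w h h<t θ = begin
      count (λ g → lookup (levelSet w h) g ∧ θ g)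
        ≡⟨ count-cong (λ g → trans (cong (_∧ θ g) (lookup-levelSet w h g))
                                   (cong (λ m → Φ m g) (sym (afterPhaseII≡w g)))) ⟩
      count (λ g → Φ (afterPhaseII g) g)
        ≡⟨ PhaseII.count-fill Φ (λ _ → refl) low afterPhaseI ⟩
      count (λ g → Φ (afterPhaseI g) g) + countL (λ (x , r) → Φ (just (u x)) r) placedII
        ≡⟨ cong (_+ countL (λ (x , r) → Φ (just (u x)) r) placedII) (trans (count-cong none-before) (count-false {n})) ⟩
      countL (λ (x , r) → ⌊ u x ≟ h ⌋ ∧ θ r) placedII ∎
      where
      open ≡-Reasoning
      Φ : Maybe ℕ → Fin n → Bool
      Φ nothing  g = false
      Φ (just a) g = ⌊ a ≟ h ⌋ ∧ θ g
      none-before : ∀ g → Φ (afterPhaseI g) g ≡ false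
      none-before g with lookup q g in qg
      ... | true  rewrite afterPhaseI-q g qg = refl
      ... | false rewrite afterPhaseI≡w g qg =
        cong (_∧ θ g) (⌊⌋≡false (w g ≟ h) λ wg≡h →
          ℕP.<⇒≱ (nonq-site->t g qg) (ℕP.<⇒≤ (subst (_< t) (sym wg≡h) h<t)))

    count-level-u : ∀ h → h < t → (θ : Fin n → Bool) →
      count (λ g → lookup (levelSet u h) g ∧ θ g) ≡ countL (λ (x , r) → ⌊ u x ≟ h ⌋ ∧ θ x) placedII
    count-level-u h h<t θ = begin
      count (λ g → lookup (levelSet u h) g ∧ θ g)  ≡⟨ count-cong (λ g → cong (_∧ θ g) (lookup-levelSet u h g)) ⟩
      count ψ                                      ≡⟨ count≡countL-allFin ψ ⟩
      countL ψ (allFin n)                          ≡⟨ sym (countL-↭ ψ is↭) ⟩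
      countL ψ is                                  ≡⟨ cong (countL ψ) (sym (ListP.take++drop≡id ∣ q ∣ is)) ⟩
      countL ψ (low ++ high)                       ≡⟨ countL-++ ψ low high ⟩
      countL ψ low + countL ψ high                 ≡⟨ cong (countL ψ low +_) none-high ⟩
      countL ψ low + 0                             ≡⟨ ℕP.+-identityʳ _ ⟩
      countL ψ low                                 ≡⟨ cong (countL ψ) (sym placedII-sources) ⟩
      countL ψ (map proj₁ placedII)                ≡⟨ countL-map ψ proj₁ placedII ⟩
      countL (ψ ∘ proj₁) placedII                  ∎
      where
      open ≡-Reasoning
      ψ : Fin n → Bool
      ψ y = ⌊ u y ≟ h ⌋ ∧ θ y
      none-high : countL ψ high ≡ 0
      none-high = trans (countL-cong ψ (const false) high λ y y∈ →
                          cong (_∧ θ y) (⌊⌋≡false (u y ≟ h) (λ uy≡h → ℕP.<⇒≱ h<t (subst (t ≤_) uy≡h (high-≥t y y∈)))))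
                        (countL-false high)

    module Decreasing (p₀ : Fin n) (wp₀≡t : w p₀ ≡ t) (w-dec : WeaklyDecUpTo t w) where

      w-decreasing-on-q : ∀ {r g} → lookup q g ≡ true → r Fin.≤ g → w g ≤ w r
      w-decreasing-on-q {r} {g} qg r≤g with ℕP.m≤n⇒m<n∨m≡n r≤g
      ... | inj₁ r<g = w-dec r g r<g (q-site-≤t g qg)
      ... | inj₂ r≡g = ℕP.≤-reflexive (cong w (sym (FinP.toℕ-injective r≡g)))

      placedII-dominates : ∀ {x r} → (x , r) ∈ placedII → ∀ g → lookup q g ≡ true → x Fin.≤ g → w g ≤ u x
      placedII-dominates {x} {r} x↦r g qg x≤g = ℕP.≮⇒≥ λ x<g →
        let ok , found , ok-big = placedII-greedy x↦r in
        case firstRight∈interval ok x g r (ok-big g qg x<g) found of λ where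
          (inj₁ (_ , r≤g)) → ℕP.<⇒≱ x<g (subst (w g ≤_) (proj₂ (placedII-value x↦r)) (w-decreasing-on-q qg r≤g))
          (inj₂ (g<x , _)) → ℕP.<⇒≱ g<x x≤g

      placedII-forward : ∀ {x r} → (x , r) ∈ placedII → u x < t → x Fin.≤ r
      placedII-forward {x} {r} x↦r x<t =
        let ok , found , ok-big = placedII-greedy x↦r in
        case firstRight∈interval ok x p₀ r (ok-big p₀ q-p₀ (subst (u x <_) (sym wp₀≡t) x<t)) found of λ where
          (inj₁ (x≤r , _))       → x≤r
          (inj₂ (_ , inj₁ x≤r))  → x≤r
          (inj₂ (_ , inj₂ r≤p₀)) → contradiction (subst₂ _≤_ wp₀≡t (proj₂ (placedII-value x↦r)) (w-decreasing-on-q q-p₀ r≤p₀))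
                                                 (ℕP.<⇒≱ x<t)
        where
        q-p₀ : lookup q p₀ ≡ true
        q-p₀ = ≤t⇒q-site p₀ (ℕP.≤-reflexive wp₀≡t)

      u-decreasing : ∀ i j → i Fin.< j → u j < t → u j ≤ u i
      u-decreasing i j i<j j<t with t ≤? u i
      ... | yes t≤i = ℕP.<⇒≤ (ℕP.<-≤-trans j<t t≤i)
      ... | no  t≰i =
        let rj , j↦rj  = low-placed j (<t⇒low j j<t)
            _  , i↦ri  = low-placed i (<t⇒low i (ℕP.≰⇒> t≰i))
            q-rj , w-rj = placedII-value j↦rj
        in subst (_≤ u i) w-rj (placedII-dominates i↦ri rj q-rj (ℕP.≤-trans (ℕP.<⇒≤ i<j) (placedII-forward j↦rj j<t)))

      levelSet-≫ : ∀ h → h < t → levelSet u h ≫ levelSet w (suc h)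
      levelSet-≫ h h<t a b a∈ b∈ = ℕP.≰⇒> λ a≤b →
        let _ , a↦r = low-placed a (<t⇒low a (subst (_< t) (sym ua≡h) h<t))
            qb = ≤t⇒q-site b (subst (_≤ t) (sym wb≡h+1) h<t)
        in ℕP.<⇒≱ (ℕP.n<1+n h) (subst₂ _≤_ wb≡h+1 ua≡h (placedII-dominates a↦r b qb a≤b))
        where
        ua≡h : u a ≡ h
        ua≡h = ∈levelSet⇒ u h a a∈
        wb≡h+1 : w b ≡ suc h
        wb≡h+1 = ∈levelSet⇒ w (suc h) b b∈

      levelSet-⪰ : ∀ h → h < t → levelSet w h ⪰ levelSet u h
      levelSet-⪰ h h<t = ⪰-fromTailCounts (levelSet w h) (levelSet u h) sizes tails
        where
        sizes : count (lookup (levelSet w h)) ≡ count (lookup (levelSet u h))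
        sizes = begin
          count (lookup (levelSet w h))                      ≡⟨ count-cong (λ g → sym (∧-identityʳ (lookup (levelSet w h) g))) ⟩
          count (λ g → lookup (levelSet w h) g ∧ true)       ≡⟨ count-level-w h h<t (const true) ⟩
          countL (λ (x , r) → ⌊ u x ≟ h ⌋ ∧ true) placedII  ≡⟨ sym (count-level-u h h<t (const true)) ⟩
          count (λ g → lookup (levelSet u h) g ∧ true)       ≡⟨ count-cong (λ g → ∧-identityʳ (lookup (levelSet u h) g)) ⟩
          count (lookup (levelSet u h))                      ∎
          where open ≡-Reasoning
        tails : ∀ c → count (λ g → lookup (levelSet u h) g ∧ atLeast c g) ≤ count (λ g → lookup (levelSet w h) g ∧ atLeast c g)
        tails c = begin
          count (λ g → lookup (levelSet u h) g ∧ atLeast c g)      ≡⟨ count-level-u h h<t (atLeast c) ⟩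
          countL (λ (x , r) → ⌊ u x ≟ h ⌋ ∧ atLeast c x) placedII  ≤⟨ countL-mono _ _ placedII moves-right ⟩
          countL (λ (x , r) → ⌊ u x ≟ h ⌋ ∧ atLeast c r) placedII  ≡⟨ sym (count-level-w h h<t (atLeast c)) ⟩
          count (λ g → lookup (levelSet w h) g ∧ atLeast c g)      ∎
          where
          open ℕP.≤-Reasoning
          moves-right : ∀ p → p ∈ placedII → ⌊ u (proj₁ p) ≟ h ⌋ ∧ atLeast c (proj₁ p) ≡ true →
                        ⌊ u (proj₁ p) ≟ h ⌋ ∧ atLeast c (proj₂ p) ≡ true
          moves-right (x , r) x↦r level∧c≤x = cong₂ _∧_ x-level (⌊⌋≡true (c ≤? toℕ r) (ℕP.≤-trans c≤x x≤r))
            where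
            x-level : ⌊ u x ≟ h ⌋ ≡ true
            x-level = ∧-conicalˡ _ _ level∧c≤x
            c≤x : c ≤ toℕ x
            c≤x = ⌊⌋≡true⇒ (c ≤? toℕ x) (∧-conicalʳ _ _ level∧c≤x)
            x≤r : x Fin.≤ r
            x≤r = placedII-forward x↦r (subst (_< t) (sym (⌊⌋≡true⇒ (u x ≟ h) x-level)) h<t)

lemma5p10 : (n : ℕ) (u : Word n) → (∀ i → 1 ≤ u i) → (t : ℕ) → 0 < t →
    (q : Queue n) (is : List (Fin n)) → IsSortingOrder u is →
    (∃ λ p → queueAct q u is p ≡ t) →
    WeaklyDecUpTo t (queueAct q u is) →
    ∣ atMostSet (queueAct q u is) t ∣ ≡ ∣ q ∣ →
    WeaklyDecUpTo (t ∸ 1) u ×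
    (∀ h → 1 ≤ h → h ≤ t ∸ 1 →
      (levelSet (queueAct q u is) h ⪰ levelSet u h) ×
      (levelSet u h ≫ levelSet (queueAct q u is) (suc h)))
lemma5p10 n u _ (suc s) _ q is (is↭ , sorted) (p₀ , wp₀≡t) w-dec |atMost|≡|q| =
  (λ i j i<j uj≤s → u-decreasing i j i<j (s≤s uj≤s)) ,
  (λ h _ h≤s → levelSet-⪰ h (s≤s h≤s) , levelSet-≫ h (s≤s h≤s))
  where
  open QueueAction q u is is↭ sorted
  open AtMost.Decreasing (suc s) |atMost|≡|q| p₀ wp₀≡t w-dec
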